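{- Let $n\geq 1$ and let $I$ be a stable set of vertices of the hypercube $Q_n$. Then the collection of subsets of $[n]$ corresponding to the vertices of $Q_n$ not in $I$ is the collection of feasible sets of a delta-matroid with ground set $[n]$.
   Context: The $n$-dimensional hypercube $Q_n$ has vertex set $\{0,1\}^n$, two vertices adjacent when they differ in exactly one coordinate; each vertex is identified with the subset of $[n]=\{1,\dots,n\}$ of which it is the indicator vector. A delta-matroid $(E,\mathcal F)$ consists of a finite set $E$ and a non-empty collection $\mathcal F$ of subsets of $E$ satisfying: for all $X,Y\in\mathcal F$ and every $e\in X\bigtriangleup Y$ there exists $f\in X\bigtriangleup Y$ (possibly $f=e$) with $X\bigtriangleup\{e,f\}\in\mathcal F$. -}

module Defs where

open import Data.Nat using (ℕ)
open import Data.Bool using (_xor_)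
open import Data.Fin using (Fin)
open import Data.Fin.Subset using (Subset; _∈_; _∪_; ⁅_⁆; ∣_∣)
open import Data.Vec using (zipWith)
open import Data.Product using (∃; _×_)
open import Relation.Binary.PropositionalEquality using (_≡_)
open import Relation.Nullary using (¬_)
open import Relation.Unary using (Pred)
open import Level using (0ℓ)

-- vertices of Q_n = subsets of [n] = Fin n, as indicator vectors (Subset n = Vec Bool n)

_△_ : ∀ {n} → Subset n → Subset n → Subset n
X △ Y = zipWith _xor_ X Y

infixl 6 _△_

Adjacent : ∀ {n} → Subset n → Subset n → Set
Adjacent X Y = ∣ X △ Y ∣ ≡ 1

Stable : ∀ {n} → Pred (Subset n) 0ℓ → Set
Stable {n} I = ∀ (X Y : Subset n) → I X → I Y → ¬ Adjacent X Y

IsDeltaMatroid : (n : ℕ) → Pred (Subset n) 0ℓ → Set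
IsDeltaMatroid n F =
  (∃ λ (X : Subset n) → F X) ×
  (∀ (X Y : Subset n) → F X → F Y → ∀ (e : Fin n) → e ∈ (X △ Y) →
     ∃ λ (f : Fin n) → f ∈ (X △ Y) × F (X △ (⁅ e ⁆ ∪ ⁅ f ⁆)))

-- If X △ {e} is feasible we exchange with f = e. Otherwise X △ {e} lies in I, and since I is
-- stable its neighbour X △ {e, f} does not, for any f ≠ e in X △ Y. No such f exists only when
-- X △ Y = {e}, i.e. Y = X △ {e} ∈ I, contradicting the feasibility of Y.
module Submission where

open import Defs
open import Data.Nat using (ℕ; _≤_; suc)
open import Data.Bool.Properties using (xor-assoc; xor-same; xor-identityˡ; xor-identityʳ)
open import Data.Fin using (Fin; zero; suc; _≟_)
open import Data.Fin.Properties using (any?)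
open import Data.Fin.Subset using (Subset; _∈_; _∪_; ⁅_⁆; ⊥; _⊆_; ∣_∣)
open import Data.Fin.Subset.Properties
  using (∣⁅x⁆∣≡1; x∈⁅x⁆; x∈⁅y⁆⇒x≡y; ⊆-antisym; _∈?_; ∪-idem; ∪-identityˡ; ∪-identityʳ)
open import Data.Vec using ([]; _∷_)
open import Data.Vec.Properties using (zipWith-assoc; zipWith-identityˡ; zipWith-identityʳ)
open import Data.Product using (∃; _×_; _,_)
open import Function using (_∘_)
open import Level using (0ℓ)
open import Relation.Binary.PropositionalEquality
open import Relation.Nullary using (¬_; yes; no; contradiction)
open import Relation.Nullary.Decidable using (_×-dec_; ¬?)
open import Relation.Unary using (Pred; Decidable)

module _ {n : ℕ} where

  △-assoc : (X Y Z : Subset n) → (X △ Y) △ Z ≡ X △ (Y △ Z)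
  △-assoc = zipWith-assoc xor-assoc

  △-identityˡ : (X : Subset n) → ⊥ △ X ≡ X
  △-identityˡ = zipWith-identityˡ xor-identityˡ

  △-identityʳ : (X : Subset n) → X △ ⊥ ≡ X
  △-identityʳ = zipWith-identityʳ xor-identityʳ

△-self : ∀ {n} (X : Subset n) → X △ X ≡ ⊥
△-self []      = refl
△-self (x ∷ X) = cong₂ _∷_ (xor-same x) (△-self X)

△-cancelˡ : ∀ {n} (X Y : Subset n) → X △ (X △ Y) ≡ Y
△-cancelˡ X Y = begin
  X △ (X △ Y)  ≡⟨ △-assoc X X Y ⟨
  (X △ X) △ Y  ≡⟨ cong (_△ Y) (△-self X) ⟩
  ⊥ △ Y        ≡⟨ △-identityˡ Y ⟩
  Y            ∎
  where open ≡-Reasoning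

△⁅⁆-adjacent : ∀ {n} (X : Subset n) (f : Fin n) → Adjacent X (X △ ⁅ f ⁆)
△⁅⁆-adjacent X f = trans (cong ∣_∣ (△-cancelˡ X ⁅ f ⁆)) (∣⁅x⁆∣≡1 f)

⁅⁆∪⁅⁆≡⁅⁆△⁅⁆ : ∀ {n} {e f : Fin n} → e ≢ f → ⁅ e ⁆ ∪ ⁅ f ⁆ ≡ ⁅ e ⁆ △ ⁅ f ⁆
⁅⁆∪⁅⁆≡⁅⁆△⁅⁆ {e = zero}  {zero}  e≢f = contradiction refl e≢f
⁅⁆∪⁅⁆≡⁅⁆△⁅⁆ {e = zero}  {suc f} _   =
  cong (_ ∷_) (trans (∪-identityˡ ⁅ f ⁆) (sym (△-identityˡ ⁅ f ⁆)))
⁅⁆∪⁅⁆≡⁅⁆△⁅⁆ {e = suc e} {zero}  _   =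
  cong (_ ∷_) (trans (∪-identityʳ ⁅ e ⁆) (sym (△-identityʳ ⁅ e ⁆)))
⁅⁆∪⁅⁆≡⁅⁆△⁅⁆ {e = suc e} {suc f} e≢f = cong (_ ∷_) (⁅⁆∪⁅⁆≡⁅⁆△⁅⁆ (e≢f ∘ cong suc))

△⁅⁆-adjacent-△⁅⁆∪⁅⁆ : ∀ {n} (X : Subset n) {e f : Fin n} → e ≢ f →
                      Adjacent (X △ ⁅ e ⁆) (X △ (⁅ e ⁆ ∪ ⁅ f ⁆))
△⁅⁆-adjacent-△⁅⁆∪⁅⁆ X {e} {f} e≢f =
  subst (Adjacent (X △ ⁅ e ⁆)) X△⁅e⁆△⁅f⁆≡X△⁅e,f⁆ (△⁅⁆-adjacent (X △ ⁅ e ⁆) f)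
  where
  X△⁅e⁆△⁅f⁆≡X△⁅e,f⁆ : (X △ ⁅ e ⁆) △ ⁅ f ⁆ ≡ X △ (⁅ e ⁆ ∪ ⁅ f ⁆)
  X△⁅e⁆△⁅f⁆≡X△⁅e,f⁆ =
    trans (△-assoc X ⁅ e ⁆ ⁅ f ⁆) (cong (X △_) (sym (⁅⁆∪⁅⁆≡⁅⁆△⁅⁆ e≢f)))

≡⁅⁆-if-only-element : ∀ {n} {p : Subset n} {x : Fin n} →
                      x ∈ p → ¬ (∃ λ y → y ∈ p × y ≢ x) → p ≡ ⁅ x ⁆
≡⁅⁆-if-only-element {p = p} {x} x∈p no-other = ⊆-antisym p⊆⁅x⁆ ⁅x⁆⊆p
  where
  p⊆⁅x⁆ : p ⊆ ⁅ x ⁆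
  p⊆⁅x⁆ {y} y∈p with y ≟ x
  ... | yes refl = x∈⁅x⁆ x
  ... | no y≢x   = contradiction (y , y∈p , y≢x) no-other

  ⁅x⁆⊆p : ⁅ x ⁆ ⊆ p
  ⁅x⁆⊆p y∈⁅x⁆ = subst (_∈ p) (sym (x∈⁅y⁆⇒x≡y x y∈⁅x⁆)) x∈p

module _ {n : ℕ} {I : Pred (Subset n) 0ℓ} (I? : Decidable I) (stable : Stable I) where

  complement-nonempty : Fin n → ∃ λ X → ¬ I X
  complement-nonempty e with I? ⊥
  ... | no ⊥∉I  = ⊥ , ⊥∉I
  ... | yes ⊥∈I = ⊥ △ ⁅ e ⁆ , λ ⁅e⁆∈I → stable _ _ ⊥∈I ⁅e⁆∈I (△⁅⁆-adjacent ⊥ e)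

  complement-exchange : ∀ (X Y : Subset n) → ¬ I X → ¬ I Y → ∀ e → e ∈ X △ Y →
                        ∃ λ f → f ∈ X △ Y × ¬ I (X △ (⁅ e ⁆ ∪ ⁅ f ⁆))
  complement-exchange X Y _ Y∉I e e∈X△Y
    with I? (X △ ⁅ e ⁆) | any? (λ f → (f ∈? X △ Y) ×-dec ¬? (f ≟ e))
  ... | no X△⁅e⁆∉I | _ = e , e∈X△Y , subst (λ Z → ¬ I (X △ Z)) (sym (∪-idem ⁅ e ⁆)) X△⁅e⁆∉I
  ... | yes X△⁅e⁆∈I | yes (f , f∈X△Y , f≢e) =
    f , f∈X△Y , λ X△⁅e,f⁆∈I →
      stable _ _ X△⁅e⁆∈I X△⁅e,f⁆∈I (△⁅⁆-adjacent-△⁅⁆∪⁅⁆ X (f≢e ∘ sym))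
  ... | yes X△⁅e⁆∈I | no no-other = contradiction (subst I X△⁅e⁆≡Y X△⁅e⁆∈I) Y∉I
    where
    X△⁅e⁆≡Y : X △ ⁅ e ⁆ ≡ Y
    X△⁅e⁆≡Y = trans (cong (X △_) (sym (≡⁅⁆-if-only-element e∈X△Y no-other))) (△-cancelˡ X Y)

lemma4 : (n : ℕ) → 1 ≤ n → (I : Pred (Subset n) 0ℓ) → Decidable I → Stable I →
           IsDeltaMatroid n (λ X → ¬ I X)
lemma4 (suc _) _ I I? stable =
  complement-nonempty I? stable zero , complement-exchange I? stable
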